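{- Let $k\ge 1$. For every instance of online unweighted any-order interval selection with revocable decisions in which the intervals have at most $k$ distinct lengths, and every arrival order, the following algorithm maintains a feasible solution and its final solution satisfies $\mathrm{OPT}\le 2k\cdot \mathrm{ALG}$. Algorithm: on arrival of an interval $I$, if $I$ conflicts with no interval of the current solution, take $I$; otherwise, if $I$ is properly contained in some interval $I'$ of the current solution ($I\subsetneq I'$), take $I$ and discard $I'$; otherwise discard $I$. (The algorithm does not need to know $k$.)
   Context: Intervals are half-open $[s_i,f_i)$ with $s_i<f_i$ real; two intervals conflict if they intersect. Intervals arrive online one at a time in an arbitrary adversarial order. The algorithm must decide immediately on each arriving interval, maintaining at all times a set of pairwise non-conflicting intervals. Revocable decisions: the algorithm may accept a newly arrived interval and simultaneously discard any currently held intervals conflicting with it; a discarded or rejected interval can never be taken again. $\mathrm{ALG}$ is the number of intervals in the final solution, $\mathrm{OPT}$ the maximum number of pairwise non-conflicting intervals among all arrived intervals; the competitive ratio is $\mathrm{OPT}/\mathrm{ALG}$ (no additive constant). The length of $[s,f)$ is $f-s$.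
   Formalization: The interval endpoints $s_i$ and $f_i$ are rational numbers instead of real numbers. -}

module Defs where

open import Data.Nat using (ℕ)
open import Data.Rational using (ℚ; _<_; _≤_; _-_)
open import Data.Rational.Properties using (_<?_; _≤?_)
open import Data.Product using (_×_; Σ)
open import Data.Sum using (_⊎_)
open import Data.List using (List; []; _∷_; foldl; removeAt; length; take)
open import Data.List.Relation.Unary.Any as Any using (Any; any?)
open import Data.List.Relation.Unary.AllPairs using (AllPairs)
open import Data.List.Relation.Unary.All using (All)
open import Data.List.Membership.Propositional using (_∈_)
open import Relation.Nullary using (¬_; Dec; yes; no)
open import Relation.Nullary.Decidable using (_×-dec_; _⊎-dec_)

-- A half-open interval [s, f) with rational endpoints, s < f.
record Interval : Set where
  constructor [_,_⟩⟨_⟩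
  field
    s   : ℚ
    f   : ℚ
    s<f : s < f
open Interval public

len : Interval → ℚ
len I = f I - s I

Conflict : Interval → Interval → Set
Conflict I J = (s I < f J) × (s J < f I)

conflict? : (I J : Interval) → Dec (Conflict I J)
conflict? I J = (s I <? f J) ×-dec (s J <? f I)

-- I ⊊ J as sets (for nonempty half-open intervals: endpoint containment, not equal)
ProperSub : Interval → Interval → Set
ProperSub I J = (s J ≤ s I) × (f I ≤ f J) × ((s J < s I) ⊎ (f I < f J))

properSub? : (I J : Interval) → Dec (ProperSub I J)
properSub? I J = (s J ≤? s I) ×-dec ((f I ≤? f J) ×-dec ((s J <? s I) ⊎-dec (f I <? f J)))

Feasible : List Interval → Set
Feasible = AllPairs (λ I J → ¬ Conflict I J)

step : List Interval → Interval → List Interval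
step S I with any? (conflict? I) S
... | no _ = I ∷ S
... | yes _ with any? (properSub? I) S
...   | yes p = I ∷ removeAt S (Any.index p)
...   | no _  = S

run : List Interval → List Interval
run σ = foldl step [] σ

AtMostKLengths : ℕ → List Interval → Set
AtMostKLengths k σ = Σ (List ℚ) λ L → (length L Data.Nat.≤ k) × All (λ I → len I ∈ L) σ

{-# OPTIONS --safe #-}
-- Let A be the list of all intervals the algorithm ever accepts. Every arriving
-- interval J conflicts with some G ∈ A without being properly nested in G: if J
-- is accepted take G = J, if it is rejected take the member of the solution it
-- conflicts with. Then J contains the left endpoint of G or a point just left
-- of the right endpoint of G, and pairwise disjoint intervals contain
-- distinct such points, so OPT ≤ 2|A|. To bound |A|, let rank ℓ be the number
-- of the k lengths that are ≥ ℓ, and charge each member X of the solution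
-- rank (len X) ≤ k. A free acceptance raises the total charge by rank ≥ 1, and
-- exchanging X for I ⊊ X raises it by rank (len I) − rank (len X) ≥ 1, since
-- len I < len X. Hence |A| ≤ total charge ≤ k·ALG.

module Submission where

open import Defs
open import Data.Nat using (ℕ; _≤_; _*_)
open import Data.List using (List; length; take)
open import Data.List.Relation.Binary.Sublist.Propositional using (_⊆_)
open import Data.Product using (_×_)

open import Data.Empty using (⊥; ⊥-elim)
open import Data.Nat using (suc; _+_; _<_; z≤n; s≤s)
open import Data.Nat.ListAction using (sum)
import Data.Nat.Properties as ℕ
open import Data.Product using (_,_; proj₂)
open import Data.Rational as ℚ using (ℚ)
import Data.Rational.Properties as ℚ
open import Data.Sum using (inj₁; inj₂)
open import Data.List using ([]; _∷_; [_]; _++_; foldl; filter; map)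
open import Data.List.Properties using (length-removeAt′; ++-assoc; ++-identityʳ; filter-some; length-filter)
open import Data.List.Relation.Unary.Any as Any using (Any; here; there; any?; _─_)
open import Data.List.Relation.Unary.Any.Properties using (lookup-result)
open import Data.List.Relation.Unary.All as All using (All; []; _∷_)
open import Data.List.Relation.Unary.All.Properties using (¬Any⇒All¬; ─⁺; ++⁺)
open import Data.List.Relation.Unary.AllPairs as AllPairs using (AllPairs; []; _∷_)
open import Data.List.Membership.Propositional using (_∈_; lose)
open import Data.List.Membership.Propositional.Properties using (∈-filter⁺; ∈-filter⁻)
open import Data.List.Relation.Binary.Pointwise using (Pointwise-≡⇒≡)
open import Data.List.Relation.Binary.Sublist.Propositional using (⊆-refl)
open import Data.List.Relation.Binary.Sublist.Propositional.Properties
  using (All-resp-⊆; filter⁺; length-mono-≤; to-≋)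
open import Algebra.Properties.CommutativeSemigroup ℕ.+-commutativeSemigroup using (x∙yz≈y∙xz)
open import Relation.Nullary using (¬_; yes; no)
open import Function using (_∘_)
open import Relation.Binary.PropositionalEquality using (_≡_; _≢_; refl; sym; trans; cong; subst)

module _ {A : Set} {P Q : A → Set} where

  Any-─ : ∀ {ys} (p : Any P ys) → Any Q ys → (∀ {y} → P y → Q y → ⊥) → Any Q (ys ─ p)
  Any-─ (here py) (here qy) disjoint = ⊥-elim (disjoint py qy)
  Any-─ (here _)  (there q) _        = q
  Any-─ (there _) (here qy) _        = here qy
  Any-─ (there p) (there q) disjoint = there (Any-─ p q disjoint)

module _ {A : Set} {P : A → Set} where

  sum-map-─ : ∀ {ys} (g : A → ℕ) (p : Any P ys) → sum (map g ys) ≡ g (Any.lookup p) + sum (map g (ys ─ p))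
  sum-map-─ g (here _)        = refl
  sum-map-─ g (there {x} p) = trans (cong (g x +_) (sum-map-─ g p)) (x∙yz≈y∙xz (g x) (g (Any.lookup p)) _)

module _ {A : Set} {P : A → Set} {R : A → A → Set} where

  AllPairs-─ : ∀ {xs} (p : Any P xs) → AllPairs R xs → AllPairs R (xs ─ p)
  AllPairs-─ (here _)  (_ ∷ rs)  = rs
  AllPairs-─ (there p) (r ∷ rs) = ─⁺ p r ∷ AllPairs-─ p rs

  AllPairs-lookup-─ : (∀ {x y} → R x y → R y x) → ∀ {xs} (p : Any P xs) → AllPairs R xs →
                      All (R (Any.lookup p)) (xs ─ p)
  AllPairs-lookup-─ _     (here _)  (r ∷ _)  = r
  AllPairs-lookup-─ R-sym (there p) (r ∷ rs) =
    R-sym (All.lookupWith (λ rxy _ → rxy) r p) ∷ AllPairs-lookup-─ R-sym p rs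

module _ {A B : Set} (R : A → B → Set) where

  pigeonhole : ∀ {xs} ys → AllPairs (λ x x′ → ∀ {y} → R x y → R x′ y → ⊥) xs →
               All (λ x → Any (R x) ys) xs → length xs ≤ length ys
  pigeonhole ys [] [] = z≤n
  pigeonhole {x ∷ xs} ys (disjoint ∷ disjoints) (w ∷ ws) = begin
    suc (length xs)        ≤⟨ s≤s (pigeonhole (ys ─ w) disjoints (All.zipWith survives (disjoint , ws))) ⟩
    suc (length (ys ─ w))  ≡⟨ length-removeAt′ ys (Any.index w) ⟨
    length ys              ∎
    where
    open ℕ.≤-Reasoning
    survives : ∀ {x′} → (∀ {y} → R x y → R x′ y → ⊥) × Any (R x′) ys → Any (R x′) (ys ─ w)
    survives (d , w′) = Any-─ w w′ d

-- below x stands for a point infinitesimally to the left of x (f G itself is not in [s G, f G)).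
data Point : Set where
  at below : ℚ → Point

Covers : Interval → Point → Set
Covers J (at x)    = s J ℚ.≤ x × x ℚ.< f J
Covers J (below x) = s J ℚ.< x × x ℚ.≤ f J

covers-conflict : ∀ {J J′} p → Covers J p → Covers J′ p → Conflict J J′
covers-conflict (at x)    (sJ≤x , x<fJ) (sJ′≤x , x<fJ′) =
  ℚ.≤-<-trans sJ≤x x<fJ′ , ℚ.≤-<-trans sJ′≤x x<fJ
covers-conflict (below x) (sJ<x , x≤fJ) (sJ′<x , x≤fJ′) =
  ℚ.<-≤-trans sJ<x x≤fJ′ , ℚ.<-≤-trans sJ′<x x≤fJ

endpoints : List Interval → List Point
endpoints []       = []
endpoints (G ∷ Gs) = at (s G) ∷ below (f G) ∷ endpoints Gs

length-endpoints : ∀ Gs → length (endpoints Gs) ≡ 2 * length Gs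
length-endpoints []       = refl
length-endpoints (G ∷ Gs) = trans (cong (2 +_) (length-endpoints Gs)) (sym (ℕ.*-suc 2 (length Gs)))

ConflictUnnested : Interval → Interval → Set
ConflictUnnested J G = Conflict J G × ¬ ProperSub J G

conflictUnnested-refl : ∀ I → ConflictUnnested I I
conflictUnnested-refl I = (s<f I , s<f I) , λ where
  (_ , _ , inj₁ s<s) → ℚ.<-irrefl refl s<s
  (_ , _ , inj₂ f<f) → ℚ.<-irrefl refl f<f

conflictUnnested⇒covers-endpoint : ∀ {J} Gs → Any (ConflictUnnested J) Gs → Any (Covers J) (endpoints Gs)
conflictUnnested⇒covers-endpoint (G ∷ Gs) (there c) = there (there (conflictUnnested⇒covers-endpoint Gs c))
conflictUnnested⇒covers-endpoint {J} (G ∷ Gs) (here ((sJ<fG , sG<fJ) , unnested))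
  with s J ℚ.≤? s G | f G ℚ.≤? f J
... | yes sJ≤sG | _         = here (sJ≤sG , sG<fJ)
... | no _      | yes fG≤fJ = there (here (sJ<fG , fG≤fJ))
... | no sJ≰sG  | no fG≰fJ  = ⊥-elim (unnested (ℚ.<⇒≤ sG<sJ , ℚ.<⇒≤ fJ<fG , inj₁ sG<sJ))
  where
  sG<sJ = ℚ.≰⇒> sJ≰sG
  fJ<fG = ℚ.≰⇒> fG≰fJ

feasible-conflictUnnested-≤ : ∀ {T} Gs → Feasible T → All (λ J → Any (ConflictUnnested J) Gs) T →
                              length T ≤ 2 * length Gs
feasible-conflictUnnested-≤ Gs feasible caught = ℕ.≤-trans
  (pigeonhole Covers (endpoints Gs)
    (AllPairs.map (λ ¬conflict {p} cJ cJ′ → ¬conflict (covers-conflict p cJ cJ′)) feasible)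
    (All.map (conflictUnnested⇒covers-endpoint Gs) caught))
  (ℕ.≤-reflexive (length-endpoints Gs))

ProperSub⇒¬Conflict : ∀ {I X} → ProperSub I X → ∀ {Y} → ¬ Conflict X Y → ¬ Conflict I Y
ProperSub⇒¬Conflict (sX≤sI , fI≤fX , _) ¬conflict (sI<fY , sY<fI) =
  ¬conflict (ℚ.≤-<-trans sX≤sI sI<fY , ℚ.<-≤-trans sY<fI fI≤fX)

ProperSub⇒len< : ∀ {I X} → ProperSub I X → len I ℚ.< len X
ProperSub⇒len< (_     , fI≤fX , inj₁ sX<sI) = ℚ.+-mono-≤-< fI≤fX (ℚ.neg-antimono-< sX<sI)
ProperSub⇒len< (sX≤sI , _     , inj₂ fI<fX) = ℚ.+-mono-<-≤ fI<fX (ℚ.neg-antimono-≤ sX≤sI)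

data StepCase (S : List Interval) (I : Interval) : List Interval → Set where
  accept   : All (λ X → ¬ Conflict I X) S → StepCase S I (I ∷ S)
  exchange : (p : Any (ProperSub I) S) → StepCase S I (I ∷ (S ─ p))
  reject   : Any (Conflict I) S → All (λ X → ¬ ProperSub I X) S → StepCase S I S

stepCase : ∀ S I → StepCase S I (step S I)
stepCase S I with any? (conflict? I) S
... | no ¬conflict = accept (¬Any⇒All¬ S ¬conflict)
... | yes conflict with any? (properSub? I) S
...   | yes nested  = exchange nested
...   | no ¬nested  = reject conflict (¬Any⇒All¬ S ¬nested)

step-feasible : ∀ {S I S′} → StepCase S I S′ → Feasible S → Feasible S′
step-feasible (accept free)   feasible = free ∷ feasible
step-feasible {S} {I} (exchange p) feasible =
  All.map (λ {Y} → ProperSub⇒¬Conflict {I} {X} (lookup-result p) {Y}) X-free ∷ AllPairs-─ p feasible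
  where
  X = Any.lookup p
  X-free : All (λ Y → ¬ Conflict X Y) (S ─ p)
  X-free = AllPairs-lookup-─ (λ ¬conflict (a , b) → ¬conflict (b , a)) p feasible
step-feasible (reject _ _)    feasible = feasible

foldl-feasible : ∀ {S} xs → Feasible S → Feasible (foldl step S xs)
foldl-feasible []       feasible = feasible
foldl-feasible (x ∷ xs) feasible = foldl-feasible xs (step-feasible (stepCase _ x) feasible)

run-feasible : ∀ σ → Feasible (run σ)
run-feasible σ = foldl-feasible σ []

module Potential (L : List ℚ) where

  rank : ℚ → ℕ
  rank q = length (filter (q ℚ.≤?_) L)

  rank-positive : ∀ {q} → q ∈ L → 0 < rank q
  rank-positive q∈L = filter-some (_ ℚ.≤?_) (Any.map (λ { refl → ℚ.≤-refl }) q∈L)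

  rank-≤ : ∀ q → rank q ≤ length L
  rank-≤ q = length-filter (q ℚ.≤?_) L

  rank-< : ∀ {p q} → p ℚ.< q → p ∈ L → rank q < rank p
  rank-< {p} {q} p<q p∈L = ℕ.≤∧≢⇒< (length-mono-≤ q⊆p) q≢p
    where
    q⊆p : filter (q ℚ.≤?_) L ⊆ filter (p ℚ.≤?_) L
    q⊆p = filter⁺ (q ℚ.≤?_) (p ℚ.≤?_) {as = L} {bs = L}
            (λ { refl q≤l → ℚ.≤-trans (ℚ.<⇒≤ p<q) q≤l }) ⊆-refl
    q≢p : rank q ≢ rank p
    q≢p same = ℚ.<-irrefl refl (ℚ.<-≤-trans p<q (proj₂ (∈-filter⁻ (q ℚ.≤?_) {xs = L} p∈filter-q)))
      where
      p∈filter-q : p ∈ filter (q ℚ.≤?_) L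
      p∈filter-q = subst (p ∈_) (sym (Pointwise-≡⇒≡ (to-≋ same q⊆p)))
                         (∈-filter⁺ (p ℚ.≤?_) p∈L ℚ.≤-refl)

  potential : List Interval → ℕ
  potential S = sum (map (rank ∘ len) S)

  potential-≤ : ∀ S → potential S ≤ length L * length S
  potential-≤ []      = ℕ.≤-reflexive (sym (ℕ.*-zeroʳ (length L)))
  potential-≤ (X ∷ S) = ℕ.≤-trans (ℕ.+-mono-≤ (rank-≤ (len X)) (potential-≤ S))
                                  (ℕ.≤-reflexive (sym (ℕ.*-suc (length L) (length S))))

  record Charged (σ S : List Interval) : Set where
    field
      accepted        : List Interval
      accepted-≤      : length accepted ≤ potential S
      current∈accepted : All (_∈ accepted) S
      arrivals-caught : All (λ J → Any (ConflictUnnested J) accepted) σ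

  charged-[] : Charged [] []
  charged-[] = record { accepted = [] ; accepted-≤ = z≤n ; current∈accepted = [] ; arrivals-caught = [] }

  accepting : ∀ {σ S S′} I (c : Charged σ S) → length (Charged.accepted c) < potential (I ∷ S′) →
              All (_∈ Charged.accepted c) S′ → Charged (σ ++ [ I ]) (I ∷ S′)
  accepting I c bound current = record
    { accepted         = I ∷ accepted
    ; accepted-≤       = bound
    ; current∈accepted = here refl ∷ All.map there current
    ; arrivals-caught  = ++⁺ (All.map there arrivals-caught) (here (conflictUnnested-refl I) ∷ [])
    }
    where open Charged c

  charged-step : ∀ {σ S I S′} → len I ∈ L → StepCase S I S′ → Charged σ S → Charged (σ ++ [ I ]) S′
  charged-step {I = I} I∈L (accept _) c =
    accepting I c (ℕ.+-mono-≤ (rank-positive I∈L) accepted-≤) current∈accepted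
    where open Charged c
  charged-step {S = S} {I} I∈L (exchange p) c = accepting I c bound (─⁺ p current∈accepted)
    where
    open Charged c
    open ℕ.≤-Reasoning
    X = Any.lookup p
    bound : length accepted < rank (len I) + potential (S ─ p)
    bound = begin-strict
      length accepted                   ≤⟨ accepted-≤ ⟩
      potential S                       ≡⟨ sum-map-─ (rank ∘ len) p ⟩
      rank (len X) + potential (S ─ p)  <⟨ ℕ.+-monoˡ-< _ (rank-< (ProperSub⇒len< {I} {X} (lookup-result p)) I∈L) ⟩
      rank (len I) + potential (S ─ p)  ∎
  charged-step _ (reject conflict unnested) c =
    let (X∈accepted , X-unnested) , X-conflict = All.lookupAny (All.zip (current∈accepted , unnested)) conflict
    in record
      { accepted         = accepted
      ; accepted-≤       = accepted-≤
      ; current∈accepted = current∈accepted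
      ; arrivals-caught  = ++⁺ arrivals-caught (lose X∈accepted (X-conflict , X-unnested) ∷ [])
      }
    where open Charged c

  charged-foldl : ∀ {σ S} xs → All (λ I → len I ∈ L) xs → Charged σ S →
                  Charged (σ ++ xs) (foldl step S xs)
  charged-foldl {σ} []       []           c = subst (λ τ → Charged τ _) (sym (++-identityʳ σ)) c
  charged-foldl {σ} (x ∷ xs) (x∈L ∷ xs∈L) c = subst (λ τ → Charged τ _) (++-assoc σ [ x ] xs)
    (charged-foldl xs xs∈L (charged-step x∈L (stepCase _ x) c))

theorem1 : (k : ℕ) → 1 ≤ k → (σ : List Interval) → AtMostKLengths k σ →
    ((n : ℕ) → Feasible (run (take n σ)))
    × ((T : List Interval) → T ⊆ σ → Feasible T → length T ≤ 2 * k * length (run σ))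
theorem1 k _ σ (L , |L|≤k , σ-lengths) = (λ n → run-feasible (take n σ)) , opt-≤
  where
  open Potential L
  open Charged (charged-foldl σ σ-lengths charged-[])
  opt-≤ : (T : List Interval) → T ⊆ σ → Feasible T → length T ≤ 2 * k * length (run σ)
  opt-≤ T T⊆σ T-feasible = begin
    length T                         ≤⟨ feasible-conflictUnnested-≤ accepted T-feasible
                                           (All-resp-⊆ T⊆σ arrivals-caught) ⟩
    2 * length accepted              ≤⟨ ℕ.*-monoʳ-≤ 2 accepted-≤ ⟩
    2 * potential (run σ)            ≤⟨ ℕ.*-monoʳ-≤ 2 (potential-≤ (run σ)) ⟩
    2 * (length L * length (run σ))  ≤⟨ ℕ.*-monoʳ-≤ 2 (ℕ.*-monoˡ-≤ (length (run σ)) |L|≤k) ⟩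
    2 * (k * length (run σ))         ≡⟨ ℕ.*-assoc 2 k (length (run σ)) ⟨
    2 * k * length (run σ)           ∎
    where open ℕ.≤-Reasoning
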